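{- If $G$ is a bridgeless cubic graph, then $\omega'(G)\le \frac{2}{3}\mu_3'(G)$.
   Context: A join of a graph $H$ is a set $J\subseteq E(H)$ such that every vertex has degrees of the same parity in $H$ and in the spanning subgraph with edge set $J$; in a cubic graph every vertex has degree $1$ or $3$ in $J$, and a vertex of degree $3$ in $J$ is a $J$-vertex; $n(J)$ denotes the number of $J$-vertices. The weak oddness $\omega'(G)$ is the minimum, over all joins $J$ of $G$, of the number of components with an odd number of vertices of the complement $(V(G),E(G)\setminus J)$. For three joins $J_1,J_2,J_3$, let $E_0$ be the set of edges in none of them; the weak core with respect to them is $G[E_0\cup E_2\cup E_3]$ (with $E_i$ the edges in exactly $i$ of the joins), and it is called a weak $l$-core where $l=|E_0|+\frac{3}{2}\sum_{i=1}^3 n(J_i)$. Then $\mu_3'(G)$ is the minimum $l$ such that $G$ has a weak $l$-core, i.e. the minimum of $|E_0|+\frac32\sum_i n(J_i)$ over all triples of joins. -}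

module Defs where

open import Data.Nat using (ℕ; zero; suc; _+_; _*_; _≤_; _%_)
open import Data.Bool using (Bool; true; false; if_then_else_; _∧_; _∨_; not)
open import Data.Fin using (Fin; zero; suc; _≟_)
open import Data.Product using (_×_; _,_; proj₁; proj₂; ∃; ∃-syntax; Σ-syntax)
open import Data.Sum using (_⊎_)
open import Data.List using (List; length)
open import Data.List.Membership.Propositional using (_∈_)
open import Data.List.Relation.Unary.Unique.Propositional using (Unique)
open import Data.List.Relation.Unary.All using (All)
open import Data.List.Relation.Unary.AllPairs using (AllPairs)
open import Relation.Nullary using (¬_)
open import Relation.Nullary.Decidable using (⌊_⌋)
open import Relation.Binary.PropositionalEquality using (_≡_; _≢_)
open import Function.Bundles using (_⇔_)

-- Finite loopless multigraph: vertices Fin n, edges Fin m, each edge has two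
-- (distinct) endpoints.  Parallel edges are allowed.
record Graph : Set where
  field
    n        : ℕ
    m        : ℕ
    ends     : Fin m → Fin n × Fin n
    loopless : ∀ e → proj₁ (ends e) ≢ proj₂ (ends e)
open Graph public

count : ∀ {k} → (Fin k → Bool) → ℕ
count {zero}  f = 0
count {suc k} f = (if f zero then 1 else 0) + count (λ i → f (suc i))

EdgeSet : Graph → Set
EdgeSet G = Fin (m G) → Bool

fullSet : (G : Graph) → EdgeSet G
fullSet G _ = true

incident : (G : Graph) → Fin (m G) → Fin (n G) → Bool
incident G e v = ⌊ proj₁ (ends G e) ≟ v ⌋ ∨ ⌊ proj₂ (ends G e) ≟ v ⌋

deg : (G : Graph) → EdgeSet G → Fin (n G) → ℕ
deg G S v = count (λ e → S e ∧ incident G e v)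

Cubic : Graph → Set
Cubic G = ∀ v → deg G (fullSet G) v ≡ 3

data Reach (G : Graph) (S : EdgeSet G) : Fin (n G) → Fin (n G) → Set where
  here : ∀ {v} → Reach G S v v
  step : ∀ {u w v} (e : Fin (m G)) → S e ≡ true →
         (ends G e ≡ (u , w) ⊎ ends G e ≡ (w , u)) →
         Reach G S w v → Reach G S u v

minusEdge : (G : Graph) → Fin (m G) → EdgeSet G
minusEdge G e f = not ⌊ f ≟ e ⌋

Bridgeless : Graph → Set
Bridgeless G = ∀ e → Reach G (minusEdge G e) (proj₁ (ends G e)) (proj₂ (ends G e))

IsJoin : (G : Graph) → EdgeSet G → Set
IsJoin G J = ∀ v → deg G J v % 2 ≡ deg G (fullSet G) v % 2

complement : (G : Graph) → EdgeSet G → EdgeSet G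
complement G J e = not (J e)

OddComponentAt : (G : Graph) → EdgeSet G → Fin (n G) → Set
OddComponentAt G S v =
  ∃[ l ] (Unique l × (∀ u → (u ∈ l) ⇔ Reach G S v u) × (length l % 2 ≡ 1))

NumOddComponents : (G : Graph) → EdgeSet G → ℕ → Set
NumOddComponents G S k =
  ∃[ reps ] ( length reps ≡ k
            × All (OddComponentAt G S) reps
            × AllPairs (λ a b → ¬ Reach G S a b) reps
            × (∀ v → OddComponentAt G S v → ∃[ r ] (r ∈ reps × Reach G S r v)))

oddOfJoin : (G : Graph) → EdgeSet G → ℕ → Set
oddOfJoin G J k = NumOddComponents G (complement G J) k

IsWeakOddness : Graph → ℕ → Set
IsWeakOddness G w =
  (∃[ J ] (IsJoin G J × oddOfJoin G J w))
  × (∀ J k → IsJoin G J → oddOfJoin G J k → w ≤ k)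

nJ : (G : Graph) → EdgeSet G → ℕ
nJ G J = count (λ v → ⌊ deg G J v Data.Nat.≟ 3 ⌋)

e0 : (G : Graph) → EdgeSet G → EdgeSet G → EdgeSet G → ℕ
e0 G J₁ J₂ J₃ = count (λ e → not (J₁ e ∨ J₂ e ∨ J₃ e))

-- twice the weak-core weight l = |E_0| + (3/2)(n(J1)+n(J2)+n(J3)),
-- i.e. 2l = 2|E_0| + 3(n(J1)+n(J2)+n(J3))  (kept in ℕ)
twiceCoreWeight : (G : Graph) → EdgeSet G → EdgeSet G → EdgeSet G → ℕ
twiceCoreWeight G J₁ J₂ J₃ = 2 * e0 G J₁ J₂ J₃ + 3 * (nJ G J₁ + nJ G J₂ + nJ G J₃)

-- Is2Mu3' G t : t = 2 μ₃'(G), i.e. t/2 is the minimum of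
-- |E_0| + (3/2) Σ n(J_i) over all triples of joins
Is2Mu3' : Graph → ℕ → Set
Is2Mu3' G t =
  (∃[ J₁ ] ∃[ J₂ ] ∃[ J₃ ] (IsJoin G J₁ × IsJoin G J₂ × IsJoin G J₃
                            × twiceCoreWeight G J₁ J₂ J₃ ≡ t))
  × (∀ J₁ J₂ J₃ → IsJoin G J₁ → IsJoin G J₂ → IsJoin G J₃
       → t ≤ twiceCoreWeight G J₁ J₂ J₃)

module Submission where

-- Let J be a join of G and Z ⊆ E ∖ J. The Z-degrees of the vertices of a component of G − J add
-- up to an even number, so every odd component of G − J contains a vertex of even Z-degree, and
-- ω'(G) is at most the number of such vertices.
--
-- Fix joins J₁, J₂, J₃ and let E₀ be the set of edges in none of them. Let X be a maximal
-- matching among those edges of E₀ that are not a whole component of (V, E₀), and take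
-- Z_i = (J_{i+1} △ X) ∖ J_i (indices mod 3). Applying the above to each pair J_i, Z_i gives
-- 3ω'(G) ≤ Σ_v cost(v), where cost(v) is the number of i for which v has even Z_i-degree.
-- The three edges at a vertex v have only 16³ possible memberships in J₁, J₂, J₃ and X, and a
-- finite check shows cost(v) ≤ d_{E₀}(v) + 3·#{i : v is a J_i-vertex} up to a correction that v
-- borrows from or lends to its E₀-edges; by maximality of X, every E₀-edge lends at least what
-- its two ends borrow. Summing over all vertices gives 3ω'(G) ≤ 2|E₀| + 3 Σ_i n(J_i) = 2l.

open import Defs
open import Data.Nat as ℕ using (ℕ; zero; suc; _+_; _*_; _≤_; _%_; z≤n; s≤s; _≤ᵇ_; _≡ᵇ_)
import Data.Nat.Properties as ℕP
open import Data.Bool as Bool using (Bool; true; false; if_then_else_; _∧_; _∨_; not; _xor_; T)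
import Data.Bool.Properties as BoolP
open import Data.Fin as Fin using (Fin)
import Data.Fin.Properties as FinP
open import Data.Product using (_×_; _,_; proj₁; proj₂; ∃-syntax)
open import Data.Sum using (_⊎_; inj₁; inj₂; [_,_]′)
open import Data.Empty using (⊥-elim)
open import Data.List as List using (List; []; _∷_; length)
import Data.List.Properties as ListP
open import Data.List.Membership.Propositional using (_∈_; _∉_; find)
open import Data.List.Membership.Propositional.Properties using (∈-map⁺; ∈-filter⁺; ∈-filter⁻; ∈-allFin)
open import Data.List.Relation.Unary.Any using (here; there; _─_; any?)
open import Data.List.Relation.Unary.All as All using (All; []; _∷_)
open import Data.List.Relation.Unary.All.Properties using (¬Any⇒All¬; all-filter)
open import Data.List.Relation.Unary.AllPairs as AllPairs using (AllPairs; []; _∷_)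
open import Data.List.Relation.Unary.Unique.Propositional using (Unique)
import Data.List.Relation.Unary.Unique.Propositional.Properties as Unique
open import Function using (_∘_)
open import Function.Bundles using (_⇔_; mk⇔; Equivalence)
open import Relation.Binary.Definitions using (tri<; tri≈; tri>)
open import Relation.Binary.PropositionalEquality
  using (_≡_; _≢_; refl; sym; trans; cong; cong₂; subst; subst₂; module ≡-Reasoning)
open import Relation.Nullary using (¬_; Dec; yes; no; contradiction)
open import Relation.Nullary.Decidable
  using (⌊_⌋; ¬?; _×-dec_; _→-dec_; decidable-stable; ¬¬-excluded-middle)
open import Algebra.Properties.CommutativeMonoid.Sum ℕP.+-0-commutativeMonoid
  using (sum; sum-syntax; ∑-distrib-+; ∑-comm; sum-cong-≗; sum-replicate-zero)
open import Algebra.Properties.CommutativeSemigroup ℕP.+-commutativeSemigroup using (interchange)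

χ : Bool → ℕ
χ b = if b then 1 else 0

count≡∑χ : ∀ {k} (f : Fin k → Bool) → count f ≡ ∑[ i < k ] χ (f i)
count≡∑χ {zero}  f = refl
count≡∑χ {suc k} f = cong (χ (f Fin.zero) +_) (count≡∑χ (f ∘ Fin.suc))

∑-mono-≤ : ∀ {k} {f g : Fin k → ℕ} → (∀ i → f i ≤ g i) → sum f ≤ sum g
∑-mono-≤ {zero}  f≤g = z≤n
∑-mono-≤ {suc k} f≤g = ℕP.+-mono-≤ (f≤g Fin.zero) (∑-mono-≤ (f≤g ∘ Fin.suc))

∑-*ˡ : ∀ {k} c (f : Fin k → ℕ) → ∑[ i < k ] (c * f i) ≡ c * sum f
∑-*ˡ {zero}  c f = sym (ℕP.*-zeroʳ c)
∑-*ˡ {suc k} c f = trans (cong (c * f Fin.zero +_) (∑-*ˡ c (f ∘ Fin.suc)))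
                         (sym (ℕP.*-distribˡ-+ c (f Fin.zero) _))

∑-point : ∀ {k} (a : Fin k) (g : Fin k → ℕ) → ∑[ v < k ] (if ⌊ a Fin.≟ v ⌋ then g v else 0) ≡ g a
∑-point {suc k} Fin.zero    g = trans (cong (g Fin.zero +_) (sum-replicate-zero k)) (ℕP.+-identityʳ _)
∑-point {suc k} (Fin.suc a) g = trans (sum-cong-≗ suc≟suc) (∑-point a (g ∘ Fin.suc))
  where
  suc≟suc : ∀ i → (if ⌊ Fin.suc a Fin.≟ Fin.suc i ⌋ then g (Fin.suc i) else 0)
                ≡ (if ⌊ a Fin.≟ i ⌋ then g (Fin.suc i) else 0)
  suc≟suc i with a Fin.≟ i
  ... | yes _ = refl
  ... | no  _ = refl

count-cong : ∀ {k} {f g : Fin k → Bool} → (∀ i → f i ≡ g i) → count f ≡ count g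
count-cong {zero}  f≡g = refl
count-cong {suc k} f≡g = cong₂ _+_ (cong χ (f≡g Fin.zero)) (count-cong (f≡g ∘ Fin.suc))

count≤size : ∀ {k} (f : Fin k → Bool) → count f ≤ k
count≤size {zero}  f = z≤n
count≤size {suc k} f with f Fin.zero
... | true  = s≤s (count≤size (f ∘ Fin.suc))
... | false = ℕP.m≤n⇒m≤1+n (count≤size (f ∘ Fin.suc))

count-zero : ∀ k → count {k} (λ _ → false) ≡ 0
count-zero zero    = refl
count-zero (suc k) = count-zero k

1≤count : ∀ {k} (f : Fin k → Bool) i → f i ≡ true → 1 ≤ count f
1≤count f Fin.zero    fi rewrite fi = s≤s z≤n
1≤count f (Fin.suc i) fi = ℕP.≤-trans (1≤count (f ∘ Fin.suc) i fi) (ℕP.m≤n+m _ (χ (f Fin.zero)))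

2≤count : ∀ {k} (f : Fin k → Bool) i j → i ≢ j → f i ≡ true → f j ≡ true → 2 ≤ count f
2≤count f Fin.zero    Fin.zero    i≢j _  _  = ⊥-elim (i≢j refl)
2≤count f Fin.zero    (Fin.suc j) _   fi fj rewrite fi = s≤s (1≤count (f ∘ Fin.suc) j fj)
2≤count f (Fin.suc i) Fin.zero    _   fi fj rewrite fj = s≤s (1≤count (f ∘ Fin.suc) i fi)
2≤count f (Fin.suc i) (Fin.suc j) i≢j fi fj =
  ℕP.≤-trans (2≤count (f ∘ Fin.suc) i j (i≢j ∘ cong Fin.suc) fi fj) (ℕP.m≤n+m _ (χ (f Fin.zero)))

count-witness : ∀ {k} (f : Fin k → Bool) → 1 ≤ count f → ∃[ i ] f i ≡ true
count-witness {suc k} f 1≤c with f Fin.zero in f₀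
... | true  = Fin.zero , f₀
... | false with count-witness (f ∘ Fin.suc) 1≤c
...   | i , fi = Fin.suc i , fi

count-insert : ∀ {k} (X B : Fin k → Bool) e → X e ≡ false →
  count (λ f → (X f ∨ ⌊ e Fin.≟ f ⌋) ∧ B f) ≡ count (λ f → X f ∧ B f) + χ (B e)
count-insert {k} X B e Xe = begin
  count (λ f → (X f ∨ ⌊ e Fin.≟ f ⌋) ∧ B f)     ≡⟨ count≡∑χ (λ f → (X f ∨ ⌊ e Fin.≟ f ⌋) ∧ B f) ⟩
  ∑[ f < k ] χ ((X f ∨ ⌊ e Fin.≟ f ⌋) ∧ B f)    ≡⟨ sum-cong-≗ split ⟩
  ∑[ f < k ] (χ (X f ∧ B f) + at f)             ≡⟨ ∑-distrib-+ (λ f → χ (X f ∧ B f)) at ⟩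
  ∑[ f < k ] χ (X f ∧ B f) + ∑[ f < k ] at f
    ≡⟨ cong₂ _+_ (sym (count≡∑χ (λ f → X f ∧ B f))) (∑-point e (χ ∘ B)) ⟩
  count (λ f → X f ∧ B f) + χ (B e)             ∎
  where
  open ≡-Reasoning
  at : Fin k → ℕ
  at f = if ⌊ e Fin.≟ f ⌋ then χ (B f) else 0
  split : ∀ f → χ ((X f ∨ ⌊ e Fin.≟ f ⌋) ∧ B f) ≡ χ (X f ∧ B f) + at f
  split f with e Fin.≟ f
  ... | yes refl rewrite Xe = refl
  ... | no  _    rewrite BoolP.∨-identityʳ (X f) = sym (ℕP.+-identityʳ _)

∧-true⁻ : ∀ {a b} → a ∧ b ≡ true → a ≡ true × b ≡ true
∧-true⁻ {true} {true} _ = refl , refl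

∧-true⁺ : ∀ {a b} → a ≡ true → b ≡ true → a ∧ b ≡ true
∧-true⁺ refl refl = refl

isOdd : ℕ → Bool
isOdd zero    = false
isOdd (suc n) = not (isOdd n)

isOdd-+ : ∀ m n → isOdd (m + n) ≡ isOdd m xor isOdd n
isOdd-+ zero    n = refl
isOdd-+ (suc m) n = trans (cong not (isOdd-+ m n)) (BoolP.not-distribˡ-xor (isOdd m) (isOdd n))

%2≡1⇒isOdd : ∀ n → n % 2 ≡ 1 → isOdd n ≡ true
%2≡1⇒isOdd (suc zero)    _ = refl
%2≡1⇒isOdd (suc (suc n)) p = trans (BoolP.not-involutive (isOdd n)) (%2≡1⇒isOdd n p)

∑-even : ∀ {k} (f : Fin k → ℕ) → (∀ i → isOdd (f i) ≡ false) → isOdd (sum f) ≡ false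
∑-even {zero}  f _    = refl
∑-even {suc k} f even
  rewrite isOdd-+ (f Fin.zero) (sum (f ∘ Fin.suc)) | even Fin.zero | ∑-even (f ∘ Fin.suc) (even ∘ Fin.suc) = refl

sumOver : ∀ {A : Set} → List A → (A → ℕ) → ℕ
sumOver []       f = 0
sumOver (x ∷ xs) f = f x + sumOver xs f

syntax sumOver xs (λ x → e) = ∑[ x ∈ xs ] e

∑ˡ-cong : ∀ {A : Set} (xs : List A) {f g : A → ℕ} → (∀ x → f x ≡ g x) → ∑[ x ∈ xs ] f x ≡ ∑[ x ∈ xs ] g x
∑ˡ-cong []       f≡g = refl
∑ˡ-cong (x ∷ xs) f≡g = cong₂ _+_ (f≡g x) (∑ˡ-cong xs f≡g)

∑ˡ-zero : ∀ {A : Set} (xs : List A) → ∑[ x ∈ xs ] 0 ≡ 0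
∑ˡ-zero []       = refl
∑ˡ-zero (x ∷ xs) = ∑ˡ-zero xs

∑ˡ-distrib-+ : ∀ {A : Set} (xs : List A) (f g : A → ℕ) →
               ∑[ x ∈ xs ] (f x + g x) ≡ ∑[ x ∈ xs ] f x + ∑[ x ∈ xs ] g x
∑ˡ-distrib-+ []       f g = refl
∑ˡ-distrib-+ (x ∷ xs) f g = trans (cong (f x + g x +_) (∑ˡ-distrib-+ xs f g)) (interchange (f x) (g x) _ _)

∑ˡ-∑-comm : ∀ {A : Set} {k} (xs : List A) (h : A → Fin k → ℕ) →
            ∑[ x ∈ xs ] (∑[ i < k ] h x i) ≡ ∑[ i < k ] (∑[ x ∈ xs ] h x i)
∑ˡ-∑-comm {k = k} []       h = sym (sum-replicate-zero k)
∑ˡ-∑-comm         (x ∷ xs) h = trans (cong (sum (h x) +_) (∑ˡ-∑-comm xs h)) (sym (∑-distrib-+ (h x) _))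

∑ˡ-map : ∀ {A B : Set} {g : A → B} {h : B → ℕ} (xs : List A) →
         ∑[ y ∈ List.map g xs ] h y ≡ ∑[ x ∈ xs ] h (g x)
∑ˡ-map          []       = refl
∑ˡ-map {h = h} (x ∷ xs) = cong (h _ +_) (∑ˡ-map xs)

isOdd-∑ˡ-odd : ∀ {A : Set} (xs : List A) (f : A → ℕ) → All (λ x → isOdd (f x) ≡ true) xs →
               isOdd (∑[ x ∈ xs ] f x) ≡ isOdd (length xs)
isOdd-∑ˡ-odd []       f []           = refl
isOdd-∑ˡ-odd (x ∷ xs) f (odd ∷ odds)
  rewrite isOdd-+ (f x) (∑[ y ∈ xs ] f y) | odd | isOdd-∑ˡ-odd xs f odds = refl

∑ˡ-indicator-∉ : ∀ {k} (a : Fin k) (xs : List (Fin k)) → a ∉ xs → ∑[ v ∈ xs ] χ ⌊ a Fin.≟ v ⌋ ≡ 0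
∑ˡ-indicator-∉ a []       _    = refl
∑ˡ-indicator-∉ a (x ∷ xs) a∉xs with a Fin.≟ x
... | yes refl = ⊥-elim (a∉xs (here refl))
... | no  _    = ∑ˡ-indicator-∉ a xs (a∉xs ∘ there)

∑ˡ-indicator-∈ : ∀ {k} (a : Fin k) (xs : List (Fin k)) → Unique xs → a ∈ xs →
                 ∑[ v ∈ xs ] χ ⌊ a Fin.≟ v ⌋ ≡ 1
∑ˡ-indicator-∈ a (x ∷ xs) (x∉xs ∷ uxs) a∈x∷xs with a Fin.≟ x | a∈x∷xs
... | yes refl | _          = cong suc (∑ˡ-indicator-∉ a xs (λ a∈xs → All.lookup x∉xs a∈xs refl))
... | no  a≢x  | here a≡x   = ⊥-elim (a≢x a≡x)
... | no  _    | there a∈xs = ∑ˡ-indicator-∈ a xs uxs a∈xs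

∈-─ : ∀ {A : Set} {x y : A} (ys : List A) (x∈ys : x ∈ ys) → y ∈ ys → y ≢ x → y ∈ (ys ─ x∈ys)
∈-─ (_ ∷ _)  (here refl)  (here refl)  y≢x = ⊥-elim (y≢x refl)
∈-─ (_ ∷ _)  (here refl)  (there y∈ys) _   = y∈ys
∈-─ (_ ∷ _)  (there x∈ys) (here refl)  _   = here refl
∈-─ (_ ∷ ys) (there x∈ys) (there y∈ys) y≢x = there (∈-─ ys x∈ys y∈ys y≢x)

length-≤-⊆ : ∀ {A : Set} (xs ys : List A) → Unique xs → (∀ {z} → z ∈ xs → z ∈ ys) → length xs ≤ length ys
length-≤-⊆ []       ys _            _     = z≤n
length-≤-⊆ (x ∷ xs) ys (x∉xs ∷ uxs) xs⊆ys =
  subst (suc (length xs) ≤_) (sym (ListP.length-removeAt′ ys _))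
    (s≤s (length-≤-⊆ xs (ys ─ x∈ys) uxs
      (λ z∈xs → ∈-─ ys x∈ys (xs⊆ys (there z∈xs)) (λ { refl → All.lookup x∉xs z∈xs refl }))))
  where
  x∈ys = xs⊆ys (here refl)

trues : ∀ {k} → (Fin k → Bool) → List (Fin k)
trues {zero}  f = []
trues {suc k} f = if f Fin.zero then Fin.zero ∷ rest else rest
  where rest = List.map Fin.suc (trues (f ∘ Fin.suc))

length-trues : ∀ {k} (f : Fin k → Bool) → length (trues f) ≡ count f
length-trues {zero}  f = refl
length-trues {suc k} f with f Fin.zero
... | true  = cong suc (trans (ListP.length-map Fin.suc (trues (f ∘ Fin.suc))) (length-trues (f ∘ Fin.suc)))
... | false = trans (ListP.length-map Fin.suc (trues (f ∘ Fin.suc))) (length-trues (f ∘ Fin.suc))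

∈-trues : ∀ {k} (f : Fin k → Bool) {i} → f i ≡ true → i ∈ trues f
∈-trues {suc k} f {Fin.zero}  fi rewrite fi = here refl
∈-trues {suc k} f {Fin.suc i} fi with f Fin.zero
... | true  = there (∈-map⁺ Fin.suc (∈-trues (f ∘ Fin.suc) fi))
... | false = ∈-map⁺ Fin.suc (∈-trues (f ∘ Fin.suc) fi)

∑-if≡∑ˡ-trues : ∀ {k} (f : Fin k → Bool) (h : Fin k → ℕ) →
                ∑[ i < k ] (if f i then h i else 0) ≡ ∑[ i ∈ trues f ] h i
∑-if≡∑ˡ-trues {zero}  f h = refl
∑-if≡∑ˡ-trues {suc k} f h with f Fin.zero
... | true  = cong (h Fin.zero +_)
                (trans (∑-if≡∑ˡ-trues (f ∘ Fin.suc) (h ∘ Fin.suc)) (sym (∑ˡ-map (trues (f ∘ Fin.suc)))))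
... | false = trans (∑-if≡∑ˡ-trues (f ∘ Fin.suc) (h ∘ Fin.suc)) (sym (∑ˡ-map (trues (f ∘ Fin.suc))))

length-≤-count : ∀ {k} (f : Fin k → Bool) (xs : List (Fin k)) → Unique xs → All (λ i → f i ≡ true) xs →
                 length xs ≤ count f
length-≤-count f xs uxs all-f = subst (length xs ≤_) (length-trues f)
  (length-≤-⊆ xs (trues f) uxs (λ i∈xs → ∈-trues f (All.lookup all-f i∈xs)))

¬¬-∀Fin : ∀ k {P : Fin k → Set} → (∀ i → ¬ ¬ P i) → ¬ ¬ (∀ i → P i)
¬¬-∀Fin zero    _   ¬∀ = ¬∀ (λ ())
¬¬-∀Fin (suc k) ¬¬P ¬∀ = ¬¬P Fin.zero λ p₀ →
  ¬¬-∀Fin k (¬¬P ∘ Fin.suc) λ p → ¬∀ λ { Fin.zero → p₀ ; (Fin.suc i) → p i }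

end₁ end₂ : (G : Graph) → Fin (m G) → Fin (n G)
end₁ G e = proj₁ (ends G e)
end₂ G e = proj₂ (ends G e)

module _ {G : Graph} {S : EdgeSet G} where

  Reach-trans : ∀ {u v w} → Reach G S u v → Reach G S v w → Reach G S u w
  Reach-trans here             q = q
  Reach-trans (step e Se uv p) q = step e Se uv (Reach-trans p q)

  Reach-sym : ∀ {u v} → Reach G S u v → Reach G S v u
  Reach-sym here                    = here
  Reach-sym (step e Se (inj₁ eq) p) = Reach-trans (Reach-sym p) (step e Se (inj₂ eq) here)
  Reach-sym (step e Se (inj₂ eq) p) = Reach-trans (Reach-sym p) (step e Se (inj₁ eq) here)

  Reach-edge : ∀ e → S e ≡ true → Reach G S (end₁ G e) (end₂ G e)
  Reach-edge e Se = step e Se (inj₁ refl) here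

  OddComponentAt-resp-Reach : ∀ {u v} → Reach G S u v → OddComponentAt G S v → OddComponentAt G S u
  OddComponentAt-resp-Reach uv (xs , uxs , xs≡C , odd) =
    xs , uxs , (λ w → mk⇔ (λ w∈xs → Reach-trans uv (Equivalence.to (xs≡C w) w∈xs))
                         (λ uw → Equivalence.from (xs≡C w) (Reach-trans (Reach-sym uv) uw))) , odd

¬¬-Reach-decidable : (G : Graph) (S : EdgeSet G) → ¬ ¬ (∀ u v → Dec (Reach G S u v))
¬¬-Reach-decidable G S = ¬¬-∀Fin (n G) λ u → ¬¬-∀Fin (n G) λ v → ¬¬-excluded-middle

module _ (G : Graph) where

  if-incident : ∀ e v {y : ℕ} → (if incident G e v then y else 0)
                               ≡ (if ⌊ end₁ G e Fin.≟ v ⌋ then y else 0) + (if ⌊ end₂ G e Fin.≟ v ⌋ then y else 0)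
  if-incident e v with end₁ G e Fin.≟ v | end₂ G e Fin.≟ v
  ... | yes refl | yes e₂≡v = ⊥-elim (loopless G e (sym e₂≡v))
  ... | yes _    | no  _    = sym (ℕP.+-identityʳ _)
  ... | no  _    | yes _    = refl
  ... | no  _    | no  _    = refl

  ends-incident : ∀ e w → incident G e w ≡ true → end₁ G e ≡ w ⊎ end₂ G e ≡ w
  ends-incident e w _ with end₁ G e Fin.≟ w | end₂ G e Fin.≟ w
  ... | yes e₁≡w | _        = inj₁ e₁≡w
  ... | no  _    | yes e₂≡w = inj₂ e₂≡w

  incident-end₁ : ∀ e → incident G e (end₁ G e) ≡ true
  incident-end₁ e with end₁ G e Fin.≟ end₁ G e
  ... | yes _     = refl
  ... | no  e₁≢e₁ = ⊥-elim (e₁≢e₁ refl)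

  incident-end₂ : ∀ e → incident G e (end₂ G e) ≡ true
  incident-end₂ e with end₂ G e Fin.≟ end₂ G e
  ... | yes _     = BoolP.∨-zeroʳ _
  ... | no  e₂≢e₂ = ⊥-elim (e₂≢e₂ refl)

  ∑-incident : ∀ e (g : Fin (n G) → ℕ) →
               ∑[ v < n G ] (if incident G e v then g v else 0) ≡ g (end₁ G e) + g (end₂ G e)
  ∑-incident e g =
    trans (sum-cong-≗ (λ v → if-incident e v))
      (trans (∑-distrib-+ (at (end₁ G e)) (at (end₂ G e)))
             (cong₂ _+_ (∑-point (end₁ G e) g) (∑-point (end₂ G e) g)))
    where
    at : Fin (n G) → Fin (n G) → ℕ
    at a v = if ⌊ a Fin.≟ v ⌋ then g v else 0

  ∑-∑-incident : (h : Fin (m G) → Fin (n G) → ℕ) →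
    ∑[ v < n G ] ∑[ e < m G ] (if incident G e v then h e v else 0) ≡ ∑[ e < m G ] (h e (end₁ G e) + h e (end₂ G e))
  ∑-∑-incident h = trans (∑-comm (λ v e → if incident G e v then h e v else 0))
                         (sum-cong-≗ (λ e → ∑-incident e (h e)))

  deg≡∑-incident : ∀ (S : EdgeSet G) v → deg G S v ≡ ∑[ e < m G ] (if incident G e v then χ (S e) else 0)
  deg≡∑-incident S v = trans (count≡∑χ (λ e → S e ∧ incident G e v)) (sum-cong-≗ χ-∧)
    where
    χ-∧ : ∀ e → χ (S e ∧ incident G e v) ≡ (if incident G e v then χ (S e) else 0)
    χ-∧ e with incident G e v
    ... | true  = cong χ (BoolP.∧-identityʳ (S e))
    ... | false = cong χ (BoolP.∧-zeroʳ (S e))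

  handshake : (S : EdgeSet G) → ∑[ v < n G ] deg G S v ≡ 2 * count S
  handshake S = begin
    ∑[ v < n G ] deg G S v                                             ≡⟨ sum-cong-≗ (deg≡∑-incident S) ⟩
    ∑[ v < n G ] ∑[ e < m G ] (if incident G e v then χ (S e) else 0) ≡⟨ ∑-∑-incident (λ e _ → χ (S e)) ⟩
    ∑[ e < m G ] (χ (S e) + χ (S e))                                  ≡⟨ ∑-distrib-+ (χ ∘ S) (χ ∘ S) ⟩
    ∑[ e < m G ] χ (S e) + ∑[ e < m G ] χ (S e)                        ≡⟨ cong (λ c → c + c) (sym (count≡∑χ S)) ⟩
    count S + count S                                                  ≡⟨ cong (count S +_) (sym (ℕP.+-identityʳ _)) ⟩
    2 * count S                                                        ∎
    where open ≡-Reasoning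

  incidentEdges : Cubic G → ∀ v → ∃[ e₁ ] ∃[ e₂ ] ∃[ e₃ ]
    (∀ h → ∑[ e < m G ] (if incident G e v then h e else 0) ≡ h e₁ + h e₂ + h e₃)
  incidentEdges cubic v
    with trues (λ e → incident G e v) | trans (length-trues (λ e → incident G e v)) (cubic v)
       | ∑-if≡∑ˡ-trues (λ e → incident G e v)
  ... | e₁ ∷ e₂ ∷ e₃ ∷ [] | _ | ∑≡ = e₁ , e₂ , e₃ , λ h →
    trans (∑≡ h) (trans (sym (ℕP.+-assoc (h e₁) _ _)) (cong (h e₁ + h e₂ +_) (ℕP.+-identityʳ (h e₃))))
  ... | []                | () | _
  ... | _ ∷ []            | () | _
  ... | _ ∷ _ ∷ []        | () | _
  ... | _ ∷ _ ∷ _ ∷ _ ∷ _ | () | _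

-- Odd components

module _ (G : Graph) where

  ∑ˡ-deg-even : (Z : EdgeSet G) (xs : List (Fin (n G))) → Unique xs →
                (∀ e → Z e ≡ true → end₁ G e ∈ xs ⇔ end₂ G e ∈ xs) →
                isOdd (∑[ v ∈ xs ] deg G Z v) ≡ false
  ∑ˡ-deg-even Z xs uxs closed = subst (λ d → isOdd d ≡ false) (sym ∑deg≡∑edges) (∑-even _ edge-even)
    where
    ∑deg≡∑edges : ∑[ v ∈ xs ] deg G Z v ≡ ∑[ e < m G ] (∑[ v ∈ xs ] χ (Z e ∧ incident G e v))
    ∑deg≡∑edges = trans (∑ˡ-cong xs (λ v → count≡∑χ (λ e → Z e ∧ incident G e v)))
                        (∑ˡ-∑-comm xs (λ v e → χ (Z e ∧ incident G e v)))

    splitEnds : ∀ e → ∑[ v ∈ xs ] χ (incident G e v)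
                      ≡ ∑[ v ∈ xs ] χ ⌊ end₁ G e Fin.≟ v ⌋ + ∑[ v ∈ xs ] χ ⌊ end₂ G e Fin.≟ v ⌋
    splitEnds e = trans (∑ˡ-cong xs (λ v → if-incident G e v)) (∑ˡ-distrib-+ xs _ _)

    edge-even : ∀ e → isOdd (∑[ v ∈ xs ] χ (Z e ∧ incident G e v)) ≡ false
    edge-even e with Z e in Ze
    ... | false = cong isOdd (∑ˡ-zero xs)
    ... | true  with any? (end₁ G e Fin.≟_) xs
    ...   | yes e₁∈xs = cong isOdd (trans (splitEnds e)
                          (cong₂ _+_ (∑ˡ-indicator-∈ _ xs uxs e₁∈xs)
                                     (∑ˡ-indicator-∈ _ xs uxs (Equivalence.to (closed e Ze) e₁∈xs))))
    ...   | no  e₁∉xs = cong isOdd (trans (splitEnds e)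
                          (cong₂ _+_ (∑ˡ-indicator-∉ _ xs e₁∉xs)
                                     (∑ˡ-indicator-∉ _ xs (e₁∉xs ∘ Equivalence.from (closed e Ze)))))

  oddComponent-has-evenVertex : (S Z : EdgeSet G) → (∀ e → Z e ≡ true → S e ≡ true) →
    ∀ r → OddComponentAt G S r → ∃[ v ] (isOdd (deg G Z v) ≡ false × Reach G S r v)
  oddComponent-has-evenVertex S Z Z⊆S r (xs , uxs , xs≡C , odd)
    with any? (λ v → isOdd (deg G Z v) Bool.≟ false) xs
  ... | yes someEven = let v , v∈xs , even = find someEven in v , even , Equivalence.to (xs≡C v) v∈xs
  ... | no  noEven   = contradiction (begin
        false                         ≡⟨ sym (∑ˡ-deg-even Z xs uxs closed) ⟩
        isOdd (∑[ v ∈ xs ] deg G Z v) ≡⟨ isOdd-∑ˡ-odd xs (deg G Z) (All.map BoolP.¬-not (¬Any⇒All¬ xs noEven)) ⟩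
        isOdd (length xs)             ≡⟨ %2≡1⇒isOdd (length xs) odd ⟩
        true                          ∎) (λ ())
    where
    open ≡-Reasoning
    closed : ∀ e → Z e ≡ true → end₁ G e ∈ xs ⇔ end₂ G e ∈ xs
    closed e Ze = mk⇔ (λ e₁∈xs → Equivalence.from (xs≡C _) (Reach-trans (Equivalence.to (xs≡C _) e₁∈xs) e₁e₂))
                      (λ e₂∈xs → Equivalence.from (xs≡C _) (Reach-trans (Equivalence.to (xs≡C _) e₂∈xs) e₂e₁))
      where
      e₁e₂ = Reach-edge e (Z⊆S e Ze)
      e₂e₁ = Reach-sym e₁e₂

module _ (G : Graph) (S : EdgeSet G) where

  private
    Apart : Fin (n G) → Fin (n G) → Set
    Apart u v = ¬ Reach G S u v

    module Witnesses (W : Fin (n G) → Bool)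
                     (hit : ∀ v → OddComponentAt G S v → ∃[ u ] (W u ≡ true × Reach G S v u)) where

      witnesses : ∀ xs → All (OddComponentAt G S) xs → AllPairs Apart xs →
        ∃[ ws ] (length ws ≡ length xs × All (λ u → W u ≡ true) ws × AllPairs Apart ws
                × All (λ u → ∃[ x ] (x ∈ xs × Reach G S x u)) ws)
      witnesses []       []            []                = [] , refl , [] , [] , []
      witnesses (x ∷ xs) (oddx ∷ odds) (x-apart ∷ apart) with hit x oddx | witnesses xs odds apart
      ... | u , Wu , xu | ws , len , Wws , ws-apart , from =
        u ∷ ws , cong suc len , Wu ∷ Wws , u-apart ∷ ws-apart ,
        (x , here refl , xu) ∷ All.map (λ (y , y∈xs , yw) → y , there y∈xs , yw) from
        where
        u-apart : All (Apart u) ws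
        u-apart = All.map (λ (y , y∈xs , yw) uw →
          All.lookup x-apart y∈xs (Reach-trans xu (Reach-trans uw (Reach-sym yw)))) from

  oddComponents≤count : ∀ {k} → NumOddComponents G S k → (W : Fin (n G) → Bool) →
    (∀ v → OddComponentAt G S v → ∃[ u ] (W u ≡ true × Reach G S v u)) → k ≤ count W
  oddComponents≤count (reps , refl , odd , apart , _) W hit =
    let ws , len , Wws , ws-apart , _ = Witnesses.witnesses W hit reps odd apart
        unique = AllPairs.map (λ uv u≡v → uv (subst (Reach G S _) u≡v here)) ws-apart
    in subst (_≤ count W) len (length-≤-count W ws unique Wws)

  module _ (reach? : ∀ u v → Dec (Reach G S u v)) where

    private
      component : Fin (n G) → List (Fin (n G))
      component v = List.filter (reach? v) (List.allFin (n G))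

      unique-component : ∀ v → Unique (component v)
      unique-component v = Unique.filter⁺ (reach? v) (Unique.allFin⁺ (n G))

      ∈-component : ∀ v u → u ∈ component v ⇔ Reach G S v u
      ∈-component v u = mk⇔ (proj₂ ∘ ∈-filter⁻ (reach? v) {xs = List.allFin (n G)})
                            (∈-filter⁺ (reach? v) (∈-allFin u))

      oddComponentAt? : ∀ v → Dec (OddComponentAt G S v)
      oddComponentAt? v with length (component v) % 2 ℕ.≟ 1
      ... | yes odd = yes (component v , unique-component v , ∈-component v , odd)
      ... | no even = no λ (xs , uxs , xs≡C , odd) → even (subst (λ l → l % 2 ≡ 1) (sameLength xs uxs xs≡C) odd)
        where
        sameLength : ∀ xs → Unique xs → (∀ u → u ∈ xs ⇔ Reach G S v u) → length xs ≡ length (component v)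
        sameLength xs uxs xs≡C = ℕP.≤-antisym
          (length-≤-⊆ xs _ uxs (λ {u} → Equivalence.from (∈-component v u) ∘ Equivalence.to (xs≡C u)))
          (length-≤-⊆ _ xs (unique-component v) (λ {u} → Equivalence.from (xs≡C u) ∘ Equivalence.to (∈-component v u)))

      IsLeast : Fin (n G) → Set
      IsLeast r = ∀ u → u Fin.< r → ¬ Reach G S r u

      least-apart : ∀ {r s} → r ≢ s → IsLeast r → IsLeast s → Apart r s
      least-apart {r} {s} r≢s least-r least-s rs with FinP.<-cmp r s
      ... | tri< r<s _ _ = least-s r r<s (Reach-sym rs)
      ... | tri≈ _ r≡s _ = r≢s r≡s
      ... | tri> _ _ s<r = least-r s s<r rs

      least-reachable : ∀ v → ∃[ r ] (Reach G S v r × IsLeast r)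
      least-reachable v
        with FinP.¬∀⟶∃¬-smallest (n G) (λ u → ¬ Reach G S v u) (¬? ∘ reach? v) (λ unreachable → unreachable v here)
      ... | r , ¬¬vr , smaller-unreachable = r , vr , least
        where
        vr = decidable-stable (reach? v r) ¬¬vr
        least : IsLeast r
        least u u<r ru = smaller-unreachable (Fin.fromℕ< u<r)
          (subst (Reach G S v) (sym (FinP.toℕ-injective (trans (FinP.toℕ-inject _) (FinP.toℕ-fromℕ< u<r))))
                 (Reach-trans vr ru))

      Representative : Fin (n G) → Set
      Representative r = IsLeast r × OddComponentAt G S r

      representative? : ∀ r → Dec (Representative r)
      representative? r = FinP.all? (λ u → (u Fin.<? r) →-dec ¬? (reach? r u)) ×-dec oddComponentAt? r

      representatives : List (Fin (n G))
      representatives = List.filter representative? (List.allFin (n G))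

      leasts-apart : ∀ xs → Unique xs → All IsLeast xs → AllPairs Apart xs
      leasts-apart []       []           []                = []
      leasts-apart (x ∷ xs) (x∉xs ∷ uxs) (least-x ∷ leasts) =
        All.zipWith (λ (x≢y , least-y) → least-apart x≢y least-x least-y) (x∉xs , leasts)
        ∷ leasts-apart xs uxs leasts

    numOddComponents : ∃[ k ] NumOddComponents G S k
    numOddComponents = length representatives , representatives , refl ,
      All.map proj₂ reps-ok ,
      leasts-apart _ (Unique.filter⁺ representative? (Unique.allFin⁺ (n G))) (All.map proj₁ reps-ok) ,
      covered
      where
      reps-ok = all-filter representative? (List.allFin (n G))
      covered : ∀ v → OddComponentAt G S v → ∃[ r ] (r ∈ representatives × Reach G S r v)
      covered v odd-v with least-reachable v
      ... | r , vr , least-r =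
        r , ∈-filter⁺ representative? (∈-allFin r) (least-r , OddComponentAt-resp-Reach (Reach-sym vr) odd-v) ,
        Reach-sym vr

evenVertices : (G : Graph) → EdgeSet G → Fin (n G) → Bool
evenVertices G Z v = not (isOdd (deg G Z v))

weakOddness≤evenVertices : ∀ G {w} J (Z : EdgeSet G) → IsWeakOddness G w → IsJoin G J →
  (∀ e → Z e ≡ true → complement G J e ≡ true) → w ≤ count (evenVertices G Z)
weakOddness≤evenVertices G J Z (_ , minimal) join Z⊆E∖J =
  -- the goal is decidable, so reachability may be assumed decidable
  decidable-stable (_ ℕ.≤? _) λ w≰ → ¬¬-Reach-decidable G E∖J λ reach? →
    let k , odd-k = numOddComponents G E∖J reach?
    in w≰ (ℕP.≤-trans (minimal J k join odd-k) (oddComponents≤count G E∖J odd-k (evenVertices G Z) hit))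
  where
  E∖J = complement G J
  hit : ∀ v → OddComponentAt G E∖J v → ∃[ u ] (evenVertices G Z u ≡ true × Reach G E∖J v u)
  hit v odd-v = let u , even , vu = oddComponent-has-evenVertex G E∖J Z Z⊆E∖J v odd-v in u , cong not even , vu

-- Maximal matchings

module _ (G : Graph) where

  record MaximalMatching (A : EdgeSet G) : Set where
    field
      X       : EdgeSet G
      X⊆A     : ∀ e → X e ≡ true → A e ≡ true
      deg≤1   : ∀ v → deg G X v ≤ 1
      maximal : ∀ e → A e ≡ true → 1 ≤ deg G X (end₁ G e) ⊎ 1 ≤ deg G X (end₂ G e)

  module _ (A : EdgeSet G) where

    private
      IsMatching : EdgeSet G → Set
      IsMatching X = (∀ e → X e ≡ true → A e ≡ true) × (∀ v → deg G X v ≤ 1)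

      Free : EdgeSet G → Fin (m G) → Set
      Free X e = A e ≡ true × deg G X (end₁ G e) ≡ 0 × deg G X (end₂ G e) ≡ 0

      free? : ∀ X e → Dec (Free X e)
      free? X e = (A e Bool.≟ true) ×-dec (deg G X (end₁ G e) ℕ.≟ 0) ×-dec (deg G X (end₂ G e) ℕ.≟ 0)

      insert : EdgeSet G → Fin (m G) → EdgeSet G
      insert X e f = X f ∨ ⌊ e Fin.≟ f ⌋

      free-unmatched : ∀ {X e} → Free X e → X e ≡ false
      free-unmatched {X} {e} (_ , d₁≡0 , _) with X e in Xe
      ... | false = refl
      ... | true  = ⊥-elim (ℕP.<⇒≱ (1≤count _ e (∧-true⁺ Xe (incident-end₁ G e))) (ℕP.≤-reflexive d₁≡0))

      insert-matching : ∀ {X e} → IsMatching X → Free X e → IsMatching (insert X e)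
      insert-matching {X} {e} (X⊆A , deg≤1) free@(Ae , d₁≡0 , d₂≡0) = X′⊆A , deg′≤1
        where
        X′⊆A : ∀ f → insert X e f ≡ true → A f ≡ true
        X′⊆A f _ with X f in Xf | e Fin.≟ f
        ... | true  | _        = X⊆A f Xf
        ... | false | yes refl = Ae

        deg′≤1 : ∀ v → deg G (insert X e) v ≤ 1
        deg′≤1 v rewrite count-insert X (λ f → incident G f v) e (free-unmatched free) with incident G e v in e∋v
        ... | false = ℕP.≤-trans (ℕP.≤-reflexive (ℕP.+-identityʳ _)) (deg≤1 v)
        ... | true  with ends-incident G e v e∋v
        ...   | inj₁ refl rewrite d₁≡0 = ℕP.≤-refl
        ...   | inj₂ refl rewrite d₂≡0 = ℕP.≤-refl

      count-insert-free : ∀ {X e} → Free X e → count (insert X e) ≡ suc (count X)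
      count-insert-free {X} {e} free =
        trans (count-cong (λ f → sym (BoolP.∧-identityʳ (insert X e f))))
          (trans (count-insert X (λ _ → true) e (free-unmatched free))
            (trans (cong (_+ 1) (count-cong (BoolP.∧-identityʳ ∘ X))) (ℕP.+-comm _ 1)))

      maximal-if-stuck : ∀ X → ¬ (∃[ e ] Free X e) →
                         ∀ e → A e ≡ true → 1 ≤ deg G X (end₁ G e) ⊎ 1 ≤ deg G X (end₂ G e)
      maximal-if-stuck X stuck e Ae with deg G X (end₁ G e) ℕ.≟ 0 | deg G X (end₂ G e) ℕ.≟ 0
      ... | no  d₁≢0 | _        = inj₁ (ℕP.n≢0⇒n>0 d₁≢0)
      ... | yes _    | no  d₂≢0 = inj₂ (ℕP.n≢0⇒n>0 d₂≢0)
      ... | yes d₁≡0 | yes d₂≡0 = ⊥-elim (stuck (e , Ae , d₁≡0 , d₂≡0))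

      grow : ∀ fuel X → IsMatching X → m G ≤ count X + fuel → MaximalMatching A
      grow fuel X matching@(X⊆A , deg≤1) room with FinP.any? (free? X)
      ... | no stuck = record { X = X ; X⊆A = X⊆A ; deg≤1 = deg≤1 ; maximal = maximal-if-stuck X stuck }
      ... | yes (e , free) with fuel
      ...   | zero     = ⊥-elim (ℕP.<⇒≱ (ℕP.≤-trans (ℕP.≤-reflexive (sym (count-insert-free free))) (count≤size _))
                                        (ℕP.≤-trans room (ℕP.≤-reflexive (ℕP.+-identityʳ _))))
      ...   | suc fuel = grow fuel (insert X e) (insert-matching matching free)
                           (ℕP.≤-trans room (ℕP.≤-reflexive
                             (trans (ℕP.+-suc _ fuel) (cong (_+ fuel) (sym (count-insert-free free))))))

    maximalMatching : MaximalMatching A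
    maximalMatching = grow (m G) (λ _ → false) ((λ _ ()) , λ v → subst (_≤ 1) (sym (count-zero (m G))) z≤n)
                           (subst (λ c → m G ≤ c + m G) (sym (count-zero (m G))) ℕP.≤-refl)

-- The local check at a vertex

record Tag : Set where
  constructor tag
  field
    j₁ j₂ j₃ x : Bool

open Tag

inE₀ inZ₁ inZ₂ inZ₃ : Tag → Bool
inE₀ t = not (j₁ t ∨ j₂ t ∨ j₃ t)
inZ₁ t = not (j₁ t) ∧ (j₂ t xor x t)
inZ₂ t = not (j₂ t) ∧ (j₃ t xor x t)
inZ₃ t = not (j₃ t) ∧ (j₁ t xor x t)

-- Discharging rules, in half units of cost: a leaf of E₀ (E₀-degree 1) covered by X costs one more
-- than its E₀-degree and borrows 2 through its X-edge; an uncovered inner vertex of E₀ costs 3 and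
-- borrows 1 through each E₀-edge; a covered inner vertex costs 0 and lends 2 through each E₀-edge.
borrow : (inX leaf : Bool) (dX : ℕ) → ℕ
borrow true  true  _    = 2
borrow false false zero = 1
borrow _     _     _    = 0

lend : (leaf : Bool) (dX : ℕ) → ℕ
lend false (suc zero) = 2
lend _     _          = 0

borrowVia lendVia : (dE₀ dX : ℕ) → Tag → ℕ
borrowVia dE₀ dX t = if inE₀ t then borrow (x t) (dE₀ ≡ᵇ 1) dX else 0
lendVia   dE₀ dX t = if inE₀ t then lend (dE₀ ≡ᵇ 1) dX else 0

module Star (t₁ t₂ t₃ : Tag) where

  through : (Tag → ℕ) → ℕ
  through h = h t₁ + h t₂ + h t₃

  degree : (Tag → Bool) → ℕ
  degree P = through (χ ∘ P)

  cost : ℕ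
  cost = χ (not (isOdd (degree inZ₁))) + χ (not (isOdd (degree inZ₂))) + χ (not (isOdd (degree inZ₃)))

  joinVertices : ℕ
  joinVertices = χ ⌊ degree j₁ ℕ.≟ 3 ⌋ + χ ⌊ degree j₂ ℕ.≟ 3 ⌋ + χ ⌊ degree j₃ ℕ.≟ 3 ⌋

  borrowed lent : ℕ
  borrowed = through (borrowVia (degree inE₀) (degree x))
  lent     = through (lendVia (degree inE₀) (degree x))

  admissible : Bool
  admissible = isOdd (degree j₁) ∧ isOdd (degree j₂) ∧ isOdd (degree j₃) ∧ (degree x ≤ᵇ 1)
             ∧ (not (x t₁) ∨ inE₀ t₁) ∧ (not (x t₂) ∨ inE₀ t₂) ∧ (not (x t₃) ∨ inE₀ t₃)

  balanced : Bool
  balanced = 2 * cost + lent ≤ᵇ 2 * degree inE₀ + 6 * joinVertices + borrowed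

∀Bool : (Bool → Bool) → Bool
∀Bool p = p false ∧ p true

∀Bool-sound : ∀ p → T (∀Bool p) → ∀ b → T (p b)
∀Bool-sound p holds false = proj₁ (Equivalence.to BoolP.T-∧ holds)
∀Bool-sound p holds true  = proj₂ (Equivalence.to BoolP.T-∧ holds)

∀Tag : (Tag → Bool) → Bool
∀Tag p = ∀Bool λ a → ∀Bool λ b → ∀Bool λ c → ∀Bool λ d → p (tag a b c d)

∀Tag-sound : ∀ p → T (∀Tag p) → ∀ t → T (p t)
∀Tag-sound p holds (tag a b c d) =
  ∀Bool-sound (λ d → p (tag a b c d))
    (∀Bool-sound (λ c → ∀Bool λ d → p (tag a b c d))
      (∀Bool-sound (λ b → ∀Bool λ c → ∀Bool λ d → p (tag a b c d))
        (∀Bool-sound (λ a → ∀Bool λ b → ∀Bool λ c → ∀Bool λ d → p (tag a b c d)) holds a) b) c) d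

star-balanced : ∀ t₁ t₂ t₃ → T (Star.admissible t₁ t₂ t₃) →
  2 * Star.cost t₁ t₂ t₃ + Star.lent t₁ t₂ t₃
  ≤ 2 * Star.degree t₁ t₂ t₃ inE₀ + 6 * Star.joinVertices t₁ t₂ t₃ + Star.borrowed t₁ t₂ t₃
star-balanced t₁ t₂ t₃ admissible = ℕP.≤ᵇ⇒≤ _ _ (implication (at-t₁t₂ t₃) admissible)
  where
  check : Tag → Tag → Tag → Bool
  check t₁ t₂ t₃ = not (Star.admissible t₁ t₂ t₃) ∨ Star.balanced t₁ t₂ t₃

  -- type checking evaluates the check on all 16³ stars
  allStars : T (∀Tag λ t₁ → ∀Tag λ t₂ → ∀Tag λ t₃ → check t₁ t₂ t₃)
  allStars = _

  at-t₁t₂ : ∀ t₃ → T (check t₁ t₂ t₃)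
  at-t₁t₂ = ∀Tag-sound (check t₁ t₂) (∀Tag-sound (λ t₂ → ∀Tag (check t₁ t₂))
              (∀Tag-sound (λ t₁ → ∀Tag λ t₂ → ∀Tag (check t₁ t₂)) allStars t₁) t₂)

  implication : ∀ {a b} → T (not a ∨ b) → T a → T b
  implication {true} b _ = b

-- Discharging along the edges of E₀

1≰0⊎1≰0 : ¬ (1 ≤ 0 ⊎ 1 ≤ 0)
1≰0⊎1≰0 = [ (λ ()) , (λ ()) ]′

borrow≤lend-matched : ∀ l₁ l₂ → l₁ ≡ false ⊎ l₂ ≡ false →
                      borrow true l₁ 1 + borrow true l₂ 1 ≤ lend l₁ 1 + lend l₂ 1
borrow≤lend-matched true  true  (inj₁ ())
borrow≤lend-matched true  true  (inj₂ ())
borrow≤lend-matched true  false _ = ℕP.≤-refl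
borrow≤lend-matched false true  _ = ℕP.≤-refl
borrow≤lend-matched false false _ = z≤n

borrow≤lend-unmatched : ∀ l₁ l₂ {c₁ c₂} → c₁ ≤ 1 → c₂ ≤ 1 → (l₁ ≡ true → c₁ ≡ 0) → (l₂ ≡ true → c₂ ≡ 0) →
  (l₁ ≡ false ⊎ l₂ ≡ false → 1 ≤ c₁ ⊎ 1 ≤ c₂) →
  borrow false l₁ c₁ + borrow false l₂ c₂ ≤ lend l₁ c₁ + lend l₂ c₂
borrow≤lend-unmatched true  true  _         _         _    _    _       = z≤n
borrow≤lend-unmatched true  false z≤n       z≤n       _    _    covered = contradiction (covered (inj₂ refl)) 1≰0⊎1≰0
borrow≤lend-unmatched false _     z≤n       z≤n       _    _    covered = contradiction (covered (inj₁ refl)) 1≰0⊎1≰0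
borrow≤lend-unmatched true  false _         (s≤s z≤n) _    _    _       = z≤n
borrow≤lend-unmatched false true  (s≤s z≤n) _         _    _    _       = z≤n
borrow≤lend-unmatched false true  z≤n       (s≤s z≤n) _    c₂≡0 _       = contradiction (c₂≡0 refl) ℕP.1+n≢0
borrow≤lend-unmatched true  false (s≤s z≤n) z≤n       c₁≡0 _    _       = contradiction (c₁≡0 refl) ℕP.1+n≢0
borrow≤lend-unmatched false false (s≤s z≤n) z≤n       _    _    _       = s≤s z≤n
borrow≤lend-unmatched false false z≤n       (s≤s z≤n) _    _    _       = s≤s z≤n
borrow≤lend-unmatched false false (s≤s z≤n) (s≤s z≤n) _    _    _       = z≤n

if-+-mono-≤ : ∀ b {p₁ p₂ q₁ q₂ : ℕ} → (b ≡ true → p₁ + p₂ ≤ q₁ + q₂) →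
  (if b then p₁ else 0) + (if b then p₂ else 0) ≤ (if b then q₁ else 0) + (if b then q₂ else 0)
if-+-mono-≤ false _   = z≤n
if-+-mono-≤ true  p≤q = p≤q refl

discharge : ∀ {a b c lent borrowed} → 2 * a + lent ≤ 2 * b + 6 * c + borrowed → borrowed ≤ lent →
            a ≤ b + 3 * c
discharge {a} {b} {c} {lent} balanced borrowed≤lent =
  ℕP.*-cancelˡ-≤ 2 (subst (2 * a ≤_) twice (ℕP.+-cancelʳ-≤ lent (2 * a) (2 * b + 6 * c)
    (ℕP.≤-trans balanced (ℕP.+-monoʳ-≤ (2 * b + 6 * c) borrowed≤lent))))
  where
  twice : 2 * b + 6 * c ≡ 2 * (b + 3 * c)
  twice = trans (cong (2 * b +_) (ℕP.*-assoc 2 3 c)) (sym (ℕP.*-distribˡ-+ 2 b (3 * c)))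

module WeakCore (G : Graph) (cubic : Cubic G) (J₁ J₂ J₃ : EdgeSet G)
                (join₁ : IsJoin G J₁) (join₂ : IsJoin G J₂) (join₃ : IsJoin G J₃) where

  E₀ : EdgeSet G
  E₀ e = not (J₁ e ∨ J₂ e ∨ J₃ e)

  leaf : Fin (n G) → Bool
  leaf v = deg G E₀ v ≡ᵇ 1

  Matchable : EdgeSet G
  Matchable e = E₀ e ∧ (not (leaf (end₁ G e)) ∨ not (leaf (end₂ G e)))

  open MaximalMatching (maximalMatching G Matchable)

  tagOf : Fin (m G) → Tag
  tagOf e = tag (J₁ e) (J₂ e) (J₃ e) (X e)

  Z₁ Z₂ Z₃ : EdgeSet G
  Z₁ = inZ₁ ∘ tagOf
  Z₂ = inZ₂ ∘ tagOf
  Z₃ = inZ₃ ∘ tagOf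

  borrowAt lendAt : Fin (m G) → Fin (n G) → ℕ
  borrowAt e v = borrowVia (deg G E₀ v) (deg G X v) (tagOf e)
  lendAt   e v = lendVia (deg G E₀ v) (deg G X v) (tagOf e)

  cost joinVertices borrowed lent : Fin (n G) → ℕ
  cost v         = χ (evenVertices G Z₁ v) + χ (evenVertices G Z₂ v) + χ (evenVertices G Z₃ v)
  joinVertices v = χ ⌊ deg G J₁ v ℕ.≟ 3 ⌋ + χ ⌊ deg G J₂ v ℕ.≟ 3 ⌋ + χ ⌊ deg G J₃ v ℕ.≟ 3 ⌋
  borrowed v     = ∑[ e < m G ] (if incident G e v then borrowAt e v else 0)
  lent v         = ∑[ e < m G ] (if incident G e v then lendAt e v else 0)

  X⊆E₀ : ∀ e → X e ≡ true → E₀ e ≡ true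
  X⊆E₀ e Xe = proj₁ (∧-true⁻ (X⊆A e Xe))

  module AtVertex (v : Fin (n G)) where

    private
      incident₃ = incidentEdges G cubic v

    e₁ e₂ e₃ : Fin (m G)
    e₁ = proj₁ incident₃
    e₂ = proj₁ (proj₂ incident₃)
    e₃ = proj₁ (proj₂ (proj₂ incident₃))

    t₁ t₂ t₃ : Tag
    t₁ = tagOf e₁
    t₂ = tagOf e₂
    t₃ = tagOf e₃

    open Star t₁ t₂ t₃ using (degree; through)

    deg≡ : ∀ P → deg G (P ∘ tagOf) v ≡ degree P
    deg≡ P = trans (deg≡∑-incident G (P ∘ tagOf) v) (proj₂ (proj₂ (proj₂ incident₃)) (χ ∘ P ∘ tagOf))

    through≡ : ∀ (h : ℕ → ℕ → Tag → ℕ) →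
      ∑[ e < m G ] (if incident G e v then h (deg G E₀ v) (deg G X v) (tagOf e) else 0)
      ≡ through (h (degree inE₀) (degree x))
    through≡ h = trans (proj₂ (proj₂ (proj₂ incident₃)) (h (deg G E₀ v) (deg G X v) ∘ tagOf))
                       (cong₂ (λ d c → through (h d c)) (deg≡ inE₀) (deg≡ x))

    cost≡ : 2 * cost v + lent v ≡ 2 * Star.cost t₁ t₂ t₃ + Star.lent t₁ t₂ t₃
    cost≡ = cong₂ _+_ (cong (2 *_) (cong₂ _+_ (cong₂ _+_ (even≡ inZ₁) (even≡ inZ₂)) (even≡ inZ₃)))
                      (through≡ lendVia)
      where
      even≡ : ∀ P → χ (evenVertices G (P ∘ tagOf) v) ≡ χ (not (isOdd (degree P)))
      even≡ P = cong (χ ∘ not ∘ isOdd) (deg≡ P)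

    share≡ : 2 * deg G E₀ v + 6 * joinVertices v + borrowed v
           ≡ 2 * degree inE₀ + 6 * Star.joinVertices t₁ t₂ t₃ + Star.borrowed t₁ t₂ t₃
    share≡ = cong₂ _+_ (cong₂ _+_ (cong (2 *_) (deg≡ inE₀)) (cong (6 *_) joinVertices≡)) (through≡ borrowVia)
      where
      joinVertex≡ : ∀ P → χ ⌊ deg G (P ∘ tagOf) v ℕ.≟ 3 ⌋ ≡ χ ⌊ degree P ℕ.≟ 3 ⌋
      joinVertex≡ P = cong (λ d → χ ⌊ d ℕ.≟ 3 ⌋) (deg≡ P)
      joinVertices≡ = cong₂ _+_ (cong₂ _+_ (joinVertex≡ j₁) (joinVertex≡ j₂)) (joinVertex≡ j₃)

    admissible : T (Star.admissible t₁ t₂ t₃)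
    admissible = odd-join j₁ join₁ & odd-join j₂ join₂ & odd-join j₃ join₃
               & ℕP.≤⇒≤ᵇ (subst (_≤ 1) (deg≡ x) (deg≤1 v))
               & X-implies-E₀ e₁ & X-implies-E₀ e₂ & X-implies-E₀ e₃
      where
      infixr 6 _&_
      _&_ : ∀ {a b} → T a → T b → T (a ∧ b)
      p & q = Equivalence.from BoolP.T-∧ (p , q)

      odd-join : ∀ P → IsJoin G (P ∘ tagOf) → T (isOdd (degree P))
      odd-join P join = Equivalence.from BoolP.T-≡ (subst (λ d → isOdd d ≡ true) (deg≡ P)
        (%2≡1⇒isOdd (deg G (P ∘ tagOf) v) (trans (join v) (cong (_% 2) (cubic v)))))

      X-implies-E₀ : ∀ e → T (not (X e) ∨ E₀ e)
      X-implies-E₀ e with X e in Xe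
      ... | false = _
      ... | true  = Equivalence.from BoolP.T-≡ (X⊆E₀ e Xe)

  vertex-balanced : ∀ v → 2 * cost v + lent v ≤ 2 * deg G E₀ v + 6 * joinVertices v + borrowed v
  vertex-balanced v = subst₂ _≤_ (sym cost≡) (sym share≡) (star-balanced t₁ t₂ t₃ admissible)
    where open AtVertex v

  matchable-inner : ∀ {e} → Matchable e ≡ true → leaf (end₁ G e) ≡ false ⊎ leaf (end₂ G e) ≡ false
  matchable-inner {e} matchable with leaf (end₁ G e) | leaf (end₂ G e) | proj₂ (∧-true⁻ {E₀ e} matchable)
  ... | false | _     | _ = inj₁ refl
  ... | true  | false | _ = inj₂ refl

  matched-covered : ∀ e w → X e ≡ true → incident G e w ≡ true → deg G X w ≡ 1
  matched-covered e w Xe e∋w = ℕP.≤-antisym (deg≤1 w) (1≤count (λ f → X f ∧ incident G f w) e (∧-true⁺ Xe e∋w))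

  leaf-uncovered : ∀ e w → E₀ e ≡ true → X e ≡ false → incident G e w ≡ true → leaf w ≡ true → deg G X w ≡ 0
  leaf-uncovered e w E₀e Xe e∋w leaf-w with deg G X w ℕ.≟ 0
  ... | yes dX≡0 = dX≡0
  ... | no  dX≢0 with count-witness (λ f → X f ∧ incident G f w) (ℕP.n≢0⇒n>0 dX≢0)
  ...   | f , Xf∧f∋w = ⊥-elim (ℕP.<⇒≱ (ℕP.≤-reflexive (cong suc d₀≡1)) two)
    where
    d₀≡1 : deg G E₀ w ≡ 1
    d₀≡1 = ℕP.≡ᵇ⇒≡ _ 1 (Equivalence.from BoolP.T-≡ leaf-w)
    Xf = proj₁ (∧-true⁻ Xf∧f∋w)
    two : 2 ≤ deg G E₀ w
    two = 2≤count (λ g → E₀ g ∧ incident G g w) e f (λ { refl → BoolP.not-¬ Xe Xf })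
                  (∧-true⁺ E₀e e∋w) (∧-true⁺ (X⊆E₀ f Xf) (proj₂ (∧-true⁻ Xf∧f∋w)))

  edge-balanced : ∀ e → E₀ e ≡ true →
    borrow (X e) (leaf (end₁ G e)) (deg G X (end₁ G e)) + borrow (X e) (leaf (end₂ G e)) (deg G X (end₂ G e))
    ≤ lend (leaf (end₁ G e)) (deg G X (end₁ G e)) + lend (leaf (end₂ G e)) (deg G X (end₂ G e))
  edge-balanced e E₀e with X e in Xe
  ... | true  rewrite matched-covered e _ Xe (incident-end₁ G e) | matched-covered e _ Xe (incident-end₂ G e)
    = borrow≤lend-matched _ _ (matchable-inner (X⊆A e Xe))
  ... | false = borrow≤lend-unmatched _ _ (deg≤1 _) (deg≤1 _)
                  (leaf-uncovered e _ E₀e Xe (incident-end₁ G e)) (leaf-uncovered e _ E₀e Xe (incident-end₂ G e))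
                  (λ someInner → maximal e (∧-true⁺ E₀e (not-∨-not someInner)))
    where
    not-∨-not : ∀ {a b} → a ≡ false ⊎ b ≡ false → not a ∨ not b ≡ true
    not-∨-not          (inj₁ refl) = refl
    not-∨-not {a = a} (inj₂ refl) = BoolP.∨-zeroʳ (not a)

  ∑borrowed≤∑lent : sum borrowed ≤ sum lent
  ∑borrowed≤∑lent = subst₂ _≤_ (sym (∑-∑-incident G borrowAt)) (sym (∑-∑-incident G lendAt))
                      (∑-mono-≤ λ e → if-+-mono-≤ (E₀ e) (edge-balanced e))

  evenVertexCount : ℕ
  evenVertexCount = count (evenVertices G Z₁) + count (evenVertices G Z₂) + count (evenVertices G Z₃)

  evenVertexCount≤twiceCoreWeight : evenVertexCount ≤ twiceCoreWeight G J₁ J₂ J₃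
  evenVertexCount≤twiceCoreWeight = subst₂ _≤_ (∑χ₃ _ _ _) (cong₂ _+_ (handshake G E₀) (cong (3 *_) (∑χ₃ _ _ _)))
    (discharge {sum cost} {sum (deg G E₀)} {sum joinVertices} ∑vertex-balanced ∑borrowed≤∑lent)
    where
    ∑vertex-balanced : 2 * sum cost + sum lent ≤ 2 * sum (deg G E₀) + 6 * sum joinVertices + sum borrowed
    ∑vertex-balanced = subst₂ _≤_
      (trans (∑-distrib-+ (λ v → 2 * cost v) lent) (cong (_+ sum lent) (∑-*ˡ 2 cost)))
      (trans (∑-distrib-+ (λ v → 2 * deg G E₀ v + 6 * joinVertices v) borrowed)
        (cong (_+ sum borrowed) (trans (∑-distrib-+ (λ v → 2 * deg G E₀ v) (λ v → 6 * joinVertices v))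
                                       (cong₂ _+_ (∑-*ˡ 2 (deg G E₀)) (∑-*ˡ 6 joinVertices)))))
      (∑-mono-≤ vertex-balanced)

    ∑χ₃ : ∀ (P Q R : Fin (n G) → Bool) → ∑[ v < n G ] (χ (P v) + χ (Q v) + χ (R v)) ≡ count P + count Q + count R
    ∑χ₃ P Q R = trans (∑-distrib-+ (λ v → χ (P v) + χ (Q v)) (χ ∘ R))
      (cong₂ _+_ (trans (∑-distrib-+ (χ ∘ P) (χ ∘ Q)) (sym (cong₂ _+_ (count≡∑χ P) (count≡∑χ Q))))
                 (sym (count≡∑χ R)))

corollary2p4 : (G : Graph) → Cubic G → Bridgeless G →
    (w t : ℕ) → IsWeakOddness G w → Is2Mu3' G t →
    3 * w ≤ t
corollary2p4 G cubic _ w t ω′ ((J₁ , J₂ , J₃ , join₁ , join₂ , join₃ , weight≡t) , _) = begin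
  3 * w                       ≡⟨ cong (λ x → w + (w + x)) (ℕP.+-identityʳ w) ⟩
  w + (w + w)                 ≡⟨ ℕP.+-assoc w w w ⟨
  w + w + w                   ≤⟨ ℕP.+-mono-≤ (ℕP.+-mono-≤ (w≤ J₁ join₁) (w≤ J₂ join₂)) (w≤ J₃ join₃) ⟩
  evenVertexCount             ≤⟨ evenVertexCount≤twiceCoreWeight ⟩
  twiceCoreWeight G J₁ J₂ J₃  ≡⟨ weight≡t ⟩
  t                           ∎
  where
  open ℕP.≤-Reasoning
  open WeakCore G cubic J₁ J₂ J₃ join₁ join₂ join₃

  w≤ : ∀ J {P : Fin (m G) → Bool} → IsJoin G J → w ≤ count (evenVertices G (λ e → not (J e) ∧ P e))
  w≤ J join = weakOddness≤evenVertices G J _ ω′ join (λ _ → proj₁ ∘ ∧-true⁻)
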